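{- Let $X$ be a finite set with $|X|\ge2$, and suppose a partition $\mathcal{P}$ of $X$ and a rooted phylogenetic tree $T$ on $X$ are compatible. Then for all distinct $A,B\in\mathcal{P}$ there are no two distinct children $u,u'$ of $\mathrm{lca}_T(A)$ such that $B\cap L(T(u))\neq\emptyset$ and $B\cap L(T(u'))\neq\emptyset$.
   Context: A rooted phylogenetic tree $T$ on $X$ is a rooted tree with leaf set $X$ in which every non-leaf vertex has at least two children; $T(u)$ is the subtree rooted at $u$ and $\mathrm{lca}_T(A)$ is the last common ancestor of a nonempty set $A\subseteq X$. For $H\subseteq E(T)$, $\mathcal{F}(T,H)$ is the partition of $X$ into leaf sets of the connected components of $T-H$; $\mathcal{P}$ and $T$ are compatible if $\mathcal{P}=\mathcal{F}(T,H)$ for some $H\subseteq E(T)$. -}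

module Defs where

open import Data.Nat using (ℕ; zero; suc; _≤_)
open import Data.Fin using (Fin)
open import Data.List using (List; []; _∷_; _++_; [_]; length; allFin)
open import Data.List.Relation.Unary.All using (All)
open import Data.List.Membership.Propositional using (_∈_)
open import Data.List.Relation.Binary.Permutation.Propositional using (_↭_)
open import Data.Maybe using (Maybe; just; nothing)
open import Data.Product using (Σ; ∃; ∃-syntax; _×_; _,_)
open import Data.Sum using (_⊎_)
open import Relation.Nullary using (¬_)
open import Relation.Binary.PropositionalEquality using (_≡_; _≢_)
open import Relation.Binary.Construct.Closure.ReflexiveTransitive using (Star)
open import Function.Bundles using (_⇔_)

data Tree (n : ℕ) : Set where
  leaf : Fin n → Tree n
  node : List (Tree n) → Tree n

data AllNodesBranch {n : ℕ} : Tree n → Set where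
  leaf : (x : Fin n) → AllNodesBranch (leaf x)
  node : (ts : List (Tree n)) → 2 ≤ length ts → All AllNodesBranch ts → AllNodesBranch (node ts)

mutual
  leaves : {n : ℕ} → Tree n → List (Fin n)
  leaves (leaf x) = x ∷ []
  leaves (node ts) = leavesList ts

  leavesList : {n : ℕ} → List (Tree n) → List (Fin n)
  leavesList [] = []
  leavesList (t ∷ ts) = leaves t ++ leavesList ts

record PhyloTree (n : ℕ) : Set where
  field
    tree     : Tree n
    branch   : AllNodesBranch tree
    leafSet  : leaves tree ↭ allFin n

-- Vertices are addressed by their path from the root: a list of child indices.
Addr : Set
Addr = List ℕ

nth : {A : Set} → List A → ℕ → Maybe A
nth [] _ = nothing
nth (a ∷ as) zero = just a
nth (a ∷ as) (suc i) = nth as i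

subtreeAt : {n : ℕ} → Tree n → Addr → Maybe (Tree n)
subtreeAt t [] = just t
subtreeAt (leaf x) (i ∷ p) = nothing
subtreeAt (node ts) (i ∷ p) with nth ts i
... | nothing = nothing
... | just t = subtreeAt t p

module _ {n : ℕ} (T : PhyloTree n) where
  open PhyloTree T

  IsVertex : Addr → Set
  IsVertex u = ∃[ s ] subtreeAt tree u ≡ just s

  InL : Addr → Fin n → Set
  InL u x = ∃[ s ] (subtreeAt tree u ≡ just s × x ∈ leaves s)

  ChildOf : Addr → Addr → Set
  ChildOf v u = IsVertex v × ∃[ i ] v ≡ u ++ [ i ]

  AncestorOrSelf : Addr → Addr → Set
  AncestorOrSelf w u = ∃[ s ] w ++ s ≡ u

  -- Each edge of T is identified with its child (lower) endpoint, a non-root vertex.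
  -- A set of edges is a predicate on addresses; H ⊆ E(T):
  EdgeSet⊆ : (Addr → Set) → Set
  EdgeSet⊆ H = ∀ u → H u → IsVertex u × u ≢ []

  AdjMinus : (Addr → Set) → Addr → Addr → Set
  AdjMinus H u v = (ChildOf v u × ¬ H v) ⊎ (ChildOf u v × ¬ H u)

  SameComponent : (Addr → Set) → Fin n → Fin n → Set
  SameComponent H x y =
    ∃[ u ] ∃[ v ] (subtreeAt tree u ≡ just (leaf x) × subtreeAt tree v ≡ just (leaf y)
                   × Star (AdjMinus H) u v)

  IsLCA : (Fin n → Set) → Addr → Set
  IsLCA A u = IsVertex u × (∀ x → A x → InL u x)
              × (∀ w → IsVertex w → (∀ x → A x → InL w x) → AncestorOrSelf w u)

record Partition (n : ℕ) : Set where
  field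
    k     : ℕ
    block : Fin n → Fin k
    nonempty : ∀ (i : Fin k) → ∃[ x ] block x ≡ i

Block : {n : ℕ} (P : Partition n) → Fin (Partition.k P) → Fin n → Set
Block P i x = Partition.block P x ≡ i

-- P = F(T,H) for some H ⊆ E(T) (equality of partitions = equality of the
-- induced "same block" relations).
Compatible : {n : ℕ} → Partition n → PhyloTree n → Set₁
Compatible P T = ∃[ H ] (EdgeSet⊆ T H ×
  (∀ x y → (Partition.block P x ≡ Partition.block P y) ⇔ SameComponent T H x y))

-- Two leaves of one block are joined by a walk in T − H, and a walk that starts
-- in the subtree of a child v·k of v and ends outside it must pass through v.
-- For x ∈ B ∩ L(T(v·i)) and y ∈ B ∩ L(T(v·j)) with i ≠ j this puts v in the
-- component of y. Since v = lca(A), some z ∈ A lies below a child v·k while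
-- another element of A does not, which puts v in the component of z as well.
-- So z and y lie in one block, contradicting A ≠ B.
module Submission where

open import Defs
open import Data.Nat using (ℕ; _≤_; zero; suc)
import Data.Nat as ℕ
open import Data.Fin using (Fin)
import Data.Fin as Fin
open import Data.Fin.Properties using (¬∀⟶∃¬)
open import Data.List using (List; []; _∷_; [_]; _++_; _∷ʳ_)
open import Data.List.Properties
  using (++-assoc; ++-identityʳ; ++-conicalˡ; ∷-injective; ∷-injectiveʳ; ∷ʳ-injectiveˡ)
open import Data.List.Membership.Propositional using (_∈_; _∉_)
open import Data.List.Membership.Propositional.Properties using (∈-++⁺ˡ; ∈-++⁺ʳ; ∈-++⁻)
import Data.List.Membership.DecPropositional as DecMembership
open import Data.List.Relation.Unary.Any using (here; there)
import Data.List.Relation.Unary.All as All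
import Data.List.Relation.Unary.All.Properties as All
open import Data.List.Relation.Unary.AllPairs using ([]; _∷_)
open import Data.List.Relation.Unary.Unique.Propositional using (Unique)
open import Data.List.Relation.Unary.Unique.Propositional.Properties using (allFin⁺)
open import Data.List.Relation.Binary.Permutation.Propositional using (↭-sym; ↭⇒↭ₛ)
open import Data.List.Relation.Binary.Permutation.Setoid.Properties using (Unique-resp-↭)
open import Data.Maybe using (just; nothing)
open import Data.Maybe.Properties using (just-injective)
open import Data.Product using (∃-syntax; _×_; _,_; proj₁)
import Data.Product as Product
open import Data.Sum using (_⊎_; inj₁; inj₂)
import Data.Sum as Sum
open import Data.Empty using (⊥-elim)
open import Function using (_∘_; id)
open import Function.Bundles using (Equivalence)
open import Relation.Nullary using (¬_; yes; no)
open import Relation.Nullary.Decidable using (_→-dec_; decidable-stable)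
open import Relation.Unary using (Decidable)
open import Relation.Binary.PropositionalEquality
  using (_≡_; _≢_; refl; sym; trans; cong; subst; setoid)
open import Relation.Binary.Construct.Closure.ReflexiveTransitive using (Star; ε; _◅_; _◅◅_)

module _ {A : Set} {R : A → A → Set} (Inside : A → Set) {v : A}
         (exit : ∀ {a b} → R a b → Inside a → Inside b ⊎ b ≡ v) where

  Star-leaves-through : ∀ {u w} → Star R u w → Inside u → ¬ Inside w →
                        Star R u v × Star R v w
  Star-leaves-through ε        inside outside = ⊥-elim (outside inside)
  Star-leaves-through (r ◅ rs) inside outside with exit r inside
  ... | inj₂ refl    = r ◅ ε , rs
  ... | inj₁ inside′ = Product.map₁ (r ◅_) (Star-leaves-through rs inside′ outside)

module _ {A : Set} where

  Unique-++⁻ˡ : ∀ (xs : List A) {ys} → Unique (xs ++ ys) → Unique xs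
  Unique-++⁻ˡ []       _          = []
  Unique-++⁻ˡ (x ∷ xs) (x∉ ∷ u) = All.++⁻ˡ xs x∉ ∷ Unique-++⁻ˡ xs u

  Unique-++⁻ʳ : ∀ (xs : List A) {ys} → Unique (xs ++ ys) → Unique ys
  Unique-++⁻ʳ []       u        = u
  Unique-++⁻ʳ (x ∷ xs) (_ ∷ u) = Unique-++⁻ʳ xs u

  Unique-++⇒disjoint : ∀ (xs : List A) {ys z} → Unique (xs ++ ys) → z ∈ xs → z ∉ ys
  Unique-++⇒disjoint (x ∷ xs) (x∉ ∷ _) (here refl) z∈ys = All.lookup (All.++⁻ʳ xs x∉) z∈ys refl
  Unique-++⇒disjoint (x ∷ xs) (_ ∷ u)  (there z∈xs) = Unique-++⇒disjoint xs u z∈xs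

infix 4 _≼_

_≼_ : Addr → Addr → Set
p ≼ u = ∃[ s ] p ++ s ≡ u

≼-∷ʳ⁺ : ∀ {p u} m → p ≼ u → p ≼ u ∷ʳ m
≼-∷ʳ⁺ {p} m (s , refl) = s ∷ʳ m , sym (++-assoc p s [ m ])

≼-∷ʳ⁻ : ∀ p u m → p ≼ u ∷ʳ m → p ≼ u ⊎ p ≡ u ∷ʳ m
≼-∷ʳ⁻ []      u       m _ = inj₁ (u , refl)
≼-∷ʳ⁻ (a ∷ p) []      m (s , eq)
  with refl , p++s≡[] ← ∷-injective eq with refl ← ++-conicalˡ p s p++s≡[] = inj₂ refl
≼-∷ʳ⁻ (a ∷ p) (b ∷ u) m (s , eq) with refl , eq′ ← ∷-injective eq =
  Sum.map (Product.map₂ (cong (a ∷_))) (cong (a ∷_)) (≼-∷ʳ⁻ p u m (s , eq′))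

∷ʳ-⋠ : ∀ v k → ¬ v ∷ʳ k ≼ v
∷ʳ-⋠ []      k (s , ())
∷ʳ-⋠ (a ∷ v) k (s , eq) = ∷ʳ-⋠ v k (s , ∷-injectiveʳ eq)

≼-siblings : ∀ v {i j w} → v ∷ʳ i ≼ w → v ∷ʳ j ≼ w → i ≡ j
≼-siblings []      (s , refl) (s′ , eq) = sym (proj₁ (∷-injective eq))
≼-siblings (a ∷ v) (s , refl) (s′ , eq) = ≼-siblings v (s , refl) (s′ , ∷-injectiveʳ eq)

module _ {n : ℕ} where

  LeafAt : Tree n → Addr → Fin n → Set
  LeafAt t w x = subtreeAt t w ≡ just (leaf x)

  subtreeAt-node⁻ : ∀ (ts : List (Tree n)) i p {r} → subtreeAt (node ts) (i ∷ p) ≡ just r →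
                    ∃[ t ] nth ts i ≡ just t × subtreeAt t p ≡ just r
  subtreeAt-node⁻ ts i p eq with nth ts i
  ... | just t = t , refl , eq

  subtreeAt-node⁺ : ∀ (ts : List (Tree n)) i p {t r} → nth ts i ≡ just t →
                    subtreeAt t p ≡ just r → subtreeAt (node ts) (i ∷ p) ≡ just r
  subtreeAt-node⁺ ts i p eq₁ eq₂ with nth ts i
  subtreeAt-node⁺ ts i p refl eq₂ | just _ = eq₂

  subtreeAt-++ : ∀ (t : Tree n) p q {s} → subtreeAt t p ≡ just s →
                 subtreeAt t (p ++ q) ≡ subtreeAt s q
  subtreeAt-++ t         []      q refl = refl
  subtreeAt-++ (node ts) (i ∷ p) q eq with nth ts i
  ... | just t′ = subtreeAt-++ t′ p q eq

  subtreeAt-++⁻ : ∀ (t : Tree n) p q {r} → subtreeAt t (p ++ q) ≡ just r →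
                  ∃[ s ] subtreeAt t p ≡ just s × subtreeAt s q ≡ just r
  subtreeAt-++⁻ t         []      q eq = t , refl , eq
  subtreeAt-++⁻ (node ts) (i ∷ p) q eq with subtreeAt-node⁻ ts i (p ++ q) eq
  ... | t′ , ti , eq′ = Product.map₂ (Product.map₁ (subtreeAt-node⁺ ts i p ti))
                                     (subtreeAt-++⁻ t′ p q eq′)

  ∈-leavesList⁺ : ∀ (ts : List (Tree n)) i {t x} → nth ts i ≡ just t →
                  x ∈ leaves t → x ∈ leavesList ts
  ∈-leavesList⁺ (t ∷ ts) zero    refl x∈t = ∈-++⁺ˡ x∈t
  ∈-leavesList⁺ (t ∷ ts) (suc i) ti   x∈t = ∈-++⁺ʳ (leaves t) (∈-leavesList⁺ ts i ti x∈t)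

  leaves-subtreeAt-⊆ : ∀ (t : Tree n) u {s x} → subtreeAt t u ≡ just s →
                       x ∈ leaves s → x ∈ leaves t
  leaves-subtreeAt-⊆ t         []      refl x∈s = x∈s
  leaves-subtreeAt-⊆ (node ts) (i ∷ u) eq   x∈s with subtreeAt-node⁻ ts i u eq
  ... | t′ , ti , eq′ = ∈-leavesList⁺ ts i ti (leaves-subtreeAt-⊆ t′ u eq′ x∈s)

  leafAt⇒∈ : ∀ (t : Tree n) w {x} → LeafAt t w x → x ∈ leaves t
  leafAt⇒∈ t w eq = leaves-subtreeAt-⊆ t w eq (here refl)

  leafAt-childless : ∀ (t : Tree n) w {x i} → LeafAt t w x → subtreeAt t (w ∷ʳ i) ≡ nothing
  leafAt-childless t w {i = i} at = subtreeAt-++ t w [ i ] at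

  mutual
    ∈⇒leafAt : ∀ (t : Tree n) {x} → x ∈ leaves t → ∃[ w ] LeafAt t w x
    ∈⇒leafAt (leaf x)  (here refl) = [] , refl
    ∈⇒leafAt (node ts) x∈ts with ∈⇒leafAtList ts x∈ts
    ... | i , t , ti , w , eq = i ∷ w , subtreeAt-node⁺ ts i w ti eq

    ∈⇒leafAtList : ∀ (ts : List (Tree n)) {x} → x ∈ leavesList ts →
                   ∃[ i ] ∃[ t ] nth ts i ≡ just t × ∃[ w ] LeafAt t w x
    ∈⇒leafAtList (t ∷ ts) x∈ with ∈-++⁻ (leaves t) x∈
    ... | inj₁ x∈t  = zero , t , refl , ∈⇒leafAt t x∈t
    ... | inj₂ x∈ts = Product.map suc id (∈⇒leafAtList ts x∈ts)

  Unique-nth : ∀ (ts : List (Tree n)) i {t} → Unique (leavesList ts) →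
               nth ts i ≡ just t → Unique (leaves t)
  Unique-nth (t ∷ ts) zero    u refl = Unique-++⁻ˡ (leaves t) u
  Unique-nth (t ∷ ts) (suc i) u ti   = Unique-nth ts i (Unique-++⁻ʳ (leaves t) u) ti

  nth-leaves-disjoint : ∀ (ts : List (Tree n)) {i j a b x} → Unique (leavesList ts) → i ≢ j →
                        nth ts i ≡ just a → nth ts j ≡ just b → x ∈ leaves a → x ∉ leaves b
  nth-leaves-disjoint (t ∷ ts) {zero}  {zero}  u i≢j _    _    _   _ = i≢j refl
  nth-leaves-disjoint (t ∷ ts) {zero}  {suc j} u _   refl tj   x∈a x∈b =
    Unique-++⇒disjoint (leaves t) u x∈a (∈-leavesList⁺ ts j tj x∈b)
  nth-leaves-disjoint (t ∷ ts) {suc i} {zero}  u _   ti   refl x∈a x∈b =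
    Unique-++⇒disjoint (leaves t) u x∈b (∈-leavesList⁺ ts i ti x∈a)
  nth-leaves-disjoint (t ∷ ts) {suc i} {suc j} u i≢j ti tj x∈a x∈b =
    nth-leaves-disjoint ts (Unique-++⁻ʳ (leaves t) u)
                        (λ i≡j → i≢j (cong suc i≡j)) ti tj x∈a x∈b

  leafAt-unique : ∀ (t : Tree n) w w′ {x} → Unique (leaves t) →
                  LeafAt t w x → LeafAt t w′ x → w ≡ w′
  leafAt-unique t         []      []        _ _  _  = refl
  leafAt-unique (leaf _)  _       (_ ∷ _)   _ _  ()
  leafAt-unique (leaf _)  (_ ∷ _) _         _ () _
  leafAt-unique (node _)  []      _         _ () _
  leafAt-unique (node _)  _       []        _ _  ()
  leafAt-unique (node ts) (i ∷ w) (j ∷ w′) u at at′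
    with subtreeAt-node⁻ ts i w at | subtreeAt-node⁻ ts j w′ at′
  ... | t , ti , at₁ | t′ , tj , at₁′ with i ℕ.≟ j
  ... | no i≢j = ⊥-elim (nth-leaves-disjoint ts u i≢j ti tj
                           (leafAt⇒∈ t w at₁) (leafAt⇒∈ t′ w′ at₁′))
  ... | yes refl with refl ← just-injective (trans (sym ti) tj) =
    cong (i ∷_) (leafAt-unique t w w′ (Unique-nth ts i u ti) at₁ at₁′)

module _ {n : ℕ} (T : PhyloTree n) where
  open PhyloTree T

  leaves-unique : Unique (leaves tree)
  leaves-unique = Unique-resp-↭ (setoid (Fin n)) (↭⇒↭ₛ (↭-sym leafSet)) (allFin⁺ n)

  InL⇒leafAt : ∀ {u x} → InL T u x → ∃[ w ] LeafAt tree w x × u ≼ w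
  InL⇒leafAt {u} (s , at , x∈s) with ∈⇒leafAt s x∈s
  ... | w , sw = u ++ w , trans (subtreeAt-++ tree u w at) sw , w , refl

  ≼⇒InL : ∀ {u w x} → LeafAt tree w x → u ≼ w → InL T u x
  ≼⇒InL {u} at (s , refl) with subtreeAt-++⁻ tree u s at
  ... | r , ur , rs = r , ur , leafAt⇒∈ r s rs

  InL⇒≼ : ∀ {u w x} → LeafAt tree w x → InL T u x → u ≼ w
  InL⇒≼ {w = w} at x∈u with InL⇒leafAt x∈u
  ... | w′ , at′ , u≼w′ with refl ← leafAt-unique tree w w′ leaves-unique at at′ = u≼w′

  InL-siblings-disjoint : ∀ v {i j x} → i ≢ j → InL T (v ∷ʳ i) x → ¬ InL T (v ∷ʳ j) x
  InL-siblings-disjoint v i≢j x∈i x∈j with InL⇒leafAt x∈i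
  ... | w , at , vi≼w = i≢j (≼-siblings v vi≼w (InL⇒≼ at x∈j))

  InL-child : ∀ v {i x} → InL T v x → IsVertex T (v ∷ʳ i) → ∃[ k ] InL T (v ∷ʳ k) x
  InL-child v {i} x∈v (_ , vi) with InL⇒leafAt {v} x∈v
  ... | _ , at , (k ∷ s , refl) = k , ≼⇒InL at (s , ++-assoc v [ k ] s)
  ... | _ , at , ([] , refl) with () ←
    trans (sym vi) (leafAt-childless tree v (subst (λ w → LeafAt tree w _) (++-identityʳ v) at))

  InL? : ∀ u → Decidable (InL T u)
  InL? u x with subtreeAt tree u
  ... | nothing = no λ { (_ , () , _) }
  ... | just s with DecMembership._∈?_ Fin._≟_ x (leaves s)
  ...   | yes x∈s = yes (s , refl , x∈s)
  ...   | no  x∉s = no λ { (_ , refl , x∈s) → x∉s x∈s }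

  lca-escapes-child : ∀ {A v k} → Decidable A → IsLCA T A v → IsVertex T (v ∷ʳ k) →
                      ∃[ z ] A z × ¬ InL T (v ∷ʳ k) z
  lca-escapes-child {A} {v} {k} A? (_ , _ , lowest) vk with
    ¬∀⟶∃¬ n (λ z → A z → InL T (v ∷ʳ k) z) (λ z → A? z →-dec InL? (v ∷ʳ k) z)
          (λ A⊆vk → ∷ʳ-⋠ v k (lowest (v ∷ʳ k) vk A⊆vk))
  ... | z , z∉ =
    z , decidable-stable (A? z) (λ ¬Az → z∉ (⊥-elim ∘ ¬Az)) , λ z∈vk → z∉ (λ _ → z∈vk)

  module _ (H : Addr → Set) where

    AdjMinus-exit : ∀ v k {a b} → AdjMinus T H a b → v ∷ʳ k ≼ a → v ∷ʳ k ≼ b ⊎ b ≡ v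
    AdjMinus-exit v k (inj₁ ((_ , m , refl) , _)) vk≼a = inj₁ (≼-∷ʳ⁺ m vk≼a)
    AdjMinus-exit v k {b = b} (inj₂ ((_ , m , refl) , _)) vk≼a =
      Sum.map₂ (λ eq → sym (∷ʳ-injectiveˡ v b eq)) (≼-∷ʳ⁻ (v ∷ʳ k) b m vk≼a)

    SameComponent-through-parent :
      ∀ v k {x y} → SameComponent T H x y → InL T (v ∷ʳ k) x → ¬ InL T (v ∷ʳ k) y →
      (∃[ u ] LeafAt tree u x × Star (AdjMinus T H) u v) ×
      (∃[ u ] LeafAt tree u y × Star (AdjMinus T H) v u)
    SameComponent-through-parent v k (u , u′ , at , at′ , walk) x∈ y∉ =
      Product.map (λ w → u , at , w) (λ w → u′ , at′ , w)
        (Star-leaves-through ((v ∷ʳ k) ≼_) (AdjMinus-exit v k) walk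
           (InL⇒≼ at x∈) (λ vk≼u′ → y∉ (≼⇒InL at′ vk≼u′)))

lemma4p2 : ∀ {n : ℕ} → 2 ≤ n → (T : PhyloTree n) → (P : Partition n) → Compatible P T →
    ∀ (a b : Fin (Partition.k P)) → a ≢ b → ∀ v → IsLCA T (Block P a) v →
    ¬ (∃[ i ] ∃[ j ] (i ≢ j × IsVertex T (v ++ [ i ]) × IsVertex T (v ++ [ j ])
    × (∃[ x ] (Block P b x × InL T (v ++ [ i ]) x))
    × (∃[ y ] (Block P b y × InL T (v ++ [ j ]) y))))
lemma4p2 _ T P (H , _ , sameBlock⇔) a b a≢b v lca@(_ , A⊆v , _)
  (i , j , i≢j , vi , _ , (x , bx , x∈i) , (y , by , y∈j))
  with z , az ← Partition.nonempty P a
  with k , z∈k@(r , vk , _) ← InL-child T v (A⊆v z az) vi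
  with z′ , az′ , z′∉k ← lca-escapes-child T (λ z → Partition.block P z Fin.≟ a)
                                              lca (r , vk)
  with (u , at , z→v) , _ ← SameComponent-through-parent T H v k
         (Equivalence.to (sameBlock⇔ z z′) (trans az (sym az′))) z∈k z′∉k
  with _ , (u′ , at′ , v→y) ← SameComponent-through-parent T H v i
         (Equivalence.to (sameBlock⇔ x y) (trans bx (sym by))) x∈i
         (λ y∈i → InL-siblings-disjoint T v i≢j y∈i y∈j)
  = a≢b (trans (sym az)
          (trans (Equivalence.from (sameBlock⇔ z y) (u , u′ , at , at′ , z→v ◅◅ v→y)) by))
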